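{- For any bipartite graph $G$, $\Theta(L(G)^2)\le\mathrm{mimsup}(G)$.
   Context: Graphs are finite, simple and loopless. For a graph $F$, $\alpha(F)$ is its independence number, $F^{\boxtimes k}$ is the strong product of $k$ copies of $F$ (vertex set $V(F)^k$; two distinct tuples are adjacent iff in each coordinate they are equal or adjacent in $F$), and the Shannon capacity is $\Theta(F)=\limsup_{k\to\infty}\alpha(F^{\boxtimes k})^{1/k}$. For a graph $G$, $L(G)^2$ is the graph with vertex set $E(G)$ in which distinct $e,e'$ are adjacent iff there is $e''\in E(G)$ (possibly $e''\in\{e,e'\}$) intersecting both $e$ and $e'$. For bipartite $G$ with classes $X,Y$, $G^{\otimes k}$ is the bipartite graph on $X^k\cup Y^k$ where $(x_1,\dots,x_k)(y_1,\dots,y_k)$ is an edge iff $x_iy_i\in E(G)$ for all $i$; $\mathrm{mim}$ of a bipartite graph is the maximum size of an induced matching; and $\mathrm{mimsup}(G)=\limsup_{k\to\infty}\mathrm{mim}(G^{\otimes k})^{1/k}$. -}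

module Defs where

open import Data.Nat using (ℕ; _*_; _^_; _≤_; _<_)
open import Data.Fin using (Fin)
open import Data.Bool using (Bool; true)
open import Data.Vec using (Vec; lookup)
open import Data.List using (List; length)
open import Data.List.Membership.Propositional using (_∈_)
open import Data.List.Relation.Unary.Unique.Propositional using (Unique)
open import Data.Product using (Σ; ∃; _×_; _,_; proj₁; proj₂)
open import Data.Sum using (_⊎_)
open import Relation.Binary.PropositionalEquality using (_≡_; _≢_)
open import Relation.Nullary using (¬_)

record Graph : Set₁ where
  field
    V   : Set
    Adj : V → V → Set

open Graph public

IsIndependent : (F : Graph) → List (V F) → Set
IsIndependent F S =
  Unique S × (∀ {u v} → u ∈ S → v ∈ S → ¬ Adj F u v)

HasIndependentOfSize : Graph → ℕ → Set
HasIndependentOfSize F s = Σ (List (V F)) λ S → IsIndependent F S × length S ≡ s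

StrongPower : Graph → ℕ → Graph
StrongPower F k = record
  { V   = Vec (V F) k
  ; Adj = λ u v → u ≢ v ×
            (∀ (i : Fin k) → (lookup u i ≡ lookup v i) ⊎ Adj F (lookup u i) (lookup v i))
  }

record BipRel : Set₁ where
  field
    A : Set
    B : Set
    E : A → B → Set

open BipRel public

record BipartiteGraph : Set where
  field
    nX   : ℕ
    nY   : ℕ
    edge : Fin nX → Fin nY → Bool

open BipartiteGraph public

toBipRel : BipartiteGraph → BipRel
toBipRel G = record { A = Fin (nX G) ; B = Fin (nY G) ; E = λ x y → edge G x y ≡ true }

TensorPower : BipRel → ℕ → BipRel
TensorPower H k = record
  { A = Vec (A H) k
  ; B = Vec (B H) k
  ; E = λ xs ys → ∀ (i : Fin k) → E H (lookup xs i) (lookup ys i)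
  }

IsInducedMatching : (H : BipRel) → List (A H × B H) → Set
IsInducedMatching H M =
  Unique M ×
  (∀ {m} → m ∈ M → E H (proj₁ m) (proj₂ m)) ×
  (∀ {m m'} → m ∈ M → m' ∈ M → m ≢ m' →
     (proj₁ m ≢ proj₁ m') × (proj₂ m ≢ proj₂ m') × ¬ E H (proj₁ m) (proj₂ m'))

HasInducedMatchingOfSize : BipRel → ℕ → Set
HasInducedMatchingOfSize H s =
  Σ (List (A H × B H)) λ M → IsInducedMatching H M × length M ≡ s

EdgeOf : BipartiteGraph → Set
EdgeOf G = Σ (Fin (nX G) × Fin (nY G)) λ e → edge G (proj₁ e) (proj₂ e) ≡ true

Meets : (G : BipartiteGraph) → EdgeOf G → EdgeOf G → Set
Meets G e f =
  (proj₁ (proj₁ e) ≡ proj₁ (proj₁ f)) ⊎ (proj₂ (proj₁ e) ≡ proj₂ (proj₁ f))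

LineSquare : BipartiteGraph → Graph
LineSquare G = record
  { V   = EdgeOf G
  ; Adj = λ e e' → e ≢ e' × Σ (EdgeOf G) λ e'' → Meets G e'' e × Meets G e'' e'
  }

-- limsup of k-th roots, compared with rationals, in ℕ-arithmetic.
-- A sequence is given by Has k s  ("the k-th term is ≥ s", i.e. some object of
-- size s exists at stage k); the k-th term is the max such s.

-- limsup_k (a_k)^{1/k} < p/q   (for q > 0), i.e.
-- there is a rational p'/q' < p/q with a_k ≤ (p'/q')^k for all large k.
LimsupRootLt : (ℕ → ℕ → Set) → ℕ → ℕ → Set
LimsupRootLt Has p q =
  Σ ℕ λ p' → Σ ℕ λ q' → (0 < q') × (p' * q < p * q') ×
    Σ ℕ λ K → ∀ k → K ≤ k → ∀ s → Has k s → s * q' ^ k ≤ p' ^ k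

-- limsup a_k^{1/k} ≤ limsup b_k^{1/k}  (both finite, nonnegative):
-- every positive rational strictly above the right side is strictly above the left.
LimsupRootLe : (ℕ → ℕ → Set) → (ℕ → ℕ → Set) → Set
LimsupRootLe HasA HasB =
  ∀ p q → 0 < q → LimsupRootLt HasB p q → LimsupRootLt HasA p q

ThetaLineSquare≤mimsup : BipartiteGraph → Set
ThetaLineSquare≤mimsup G =
  LimsupRootLe (λ k → HasIndependentOfSize (StrongPower (LineSquare G) k))
               (λ k → HasInducedMatchingOfSize (TensorPower (toBipRel G) k))

{-# OPTIONS --safe #-}
-- A k-tuple of edges of G is sent to the pair (its X-endpoints, its Y-endpoints), an edge of
-- G^{⊗k}. On an independent set of L(G)²^{⊠k} this gives an induced matching of the same size:
-- if two images shared their X-tuples or their Y-tuples, or were joined by a cross edge, then in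
-- every coordinate a single edge of G would meet both edges, making the tuples adjacent. So
-- α(L(G)²^{⊠k}) ≤ mim(G^{⊗k}) for every k, and the limsups compare termwise.
module Submission where

open import Defs
open import Data.Nat using (ℕ)
open import Data.Fin using (Fin)
import Data.Fin.Properties as Fin
open import Data.Bool using (true)
import Data.Bool.Properties as Bool
open import Data.Vec using (Vec; lookup; map)
open import Data.Vec.Properties using (lookup-map)
open import Data.Vec.Relation.Binary.Pointwise.Extensional using (ext; Pointwise-≡⇒≡)
open import Data.List as List using (List)
open import Data.List.Properties using (length-map)
open import Data.List.Membership.Propositional using (_∈_)
open import Data.List.Membership.Propositional.Properties using (∈-map⁻)
open import Data.List.Relation.Unary.Unique.Propositional.Properties using (map⁺)
open import Data.Product using (Σ; _×_; _,_; proj₁; proj₂)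
import Data.Product.Properties as Product
open import Data.Sum using (_⊎_; inj₁; inj₂)
open import Function using (_∘_)
open import Relation.Binary.Core using (_⇒_)
open import Relation.Binary.Definitions using (DecidableEquality)
open import Relation.Binary.PropositionalEquality
open import Relation.Nullary using (¬_; yes; no)
import Relation.Nullary.Decidable as Dec
open import Axiom.UniquenessOfIdentityProofs using (module Decidable⇒UIP)

⇒-limsupRootLe : {HasA HasB : ℕ → ℕ → Set} → HasA ⇒ HasB → LimsupRootLe HasA HasB
⇒-limsupRootLe A⇒B p q _ (p′ , q′ , 0<q′ , p′/q′<p/q , K , bound) =
  p′ , q′ , 0<q′ , p′/q′<p/q , K , λ k K≤k s → bound k K≤k s ∘ A⇒B

map-≡-lookup : ∀ {A B : Set} {k} (f : A → B) {u v : Vec A k} →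
               map f u ≡ map f v → (i : Fin k) → f (lookup u i) ≡ f (lookup v i)
map-≡-lookup f {u} {v} eq i = begin
  f (lookup u i)       ≡⟨ lookup-map i f u ⟨
  lookup (map f u) i   ≡⟨ cong (λ w → lookup w i) eq ⟩
  lookup (map f v) i   ≡⟨ lookup-map i f v ⟩
  f (lookup v i)       ∎
  where open ≡-Reasoning

module _ (G : BipartiteGraph) where

  Edge : Set
  Edge = EdgeOf G

  Strong : ℕ → Graph
  Strong = StrongPower (LineSquare G)

  Tensor : ℕ → BipRel
  Tensor = TensorPower (toBipRel G)

  xEnd : Edge → Fin (nX G)
  xEnd = proj₁ ∘ proj₁

  yEnd : Edge → Fin (nY G)
  yEnd = proj₂ ∘ proj₁

  edge-≡ : {e f : Edge} → proj₁ e ≡ proj₁ f → e ≡ f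
  edge-≡ {_ , p} {_ , q} refl = cong (_ ,_) (Decidable⇒UIP.≡-irrelevant Bool._≟_ p q)

  _≟ᴱ_ : DecidableEquality Edge
  e ≟ᴱ f = Dec.map′ edge-≡ (cong proj₁) (Product.≡-dec Fin._≟_ Fin._≟_ (proj₁ e) (proj₁ f))

  Linked : Edge → Edge → Set
  Linked e f = Σ Edge λ c → Meets G c e × Meets G c f

  linked⇒≡⊎adjacent : {e f : Edge} → Linked e f → e ≡ f ⊎ Adj (LineSquare G) e f
  linked⇒≡⊎adjacent {e} {f} link with e ≟ᴱ f
  ... | yes e≡f = inj₁ e≡f
  ... | no  e≢f = inj₂ (e≢f , link)

  linked⇒adjacent : ∀ {k} {u v : Vec Edge k} → u ≢ v →
                    (∀ i → Linked (lookup u i) (lookup v i)) →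
                    Adj (Strong k) u v
  linked⇒adjacent u≢v link = u≢v , linked⇒≡⊎adjacent ∘ link

  xEnds : ∀ {k} → Vec Edge k → Vec (Fin (nX G)) k
  xEnds = map xEnd

  yEnds : ∀ {k} → Vec Edge k → Vec (Fin (nY G)) k
  yEnds = map yEnd

  endpoints : ∀ {k} → Vec Edge k → A (Tensor k) × B (Tensor k)
  endpoints u = xEnds u , yEnds u

  endpoints-injective : ∀ {k} {u v : Vec Edge k} → endpoints u ≡ endpoints v → u ≡ v
  endpoints-injective eq = Pointwise-≡⇒≡ (ext λ i →
    edge-≡ (cong₂ _,_ (map-≡-lookup xEnd (cong proj₁ eq) i) (map-≡-lookup yEnd (cong proj₂ eq) i)))

  endpoints-edge : ∀ {k} (u : Vec Edge k) → E (Tensor k) (xEnds u) (yEnds u)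
  endpoints-edge u i =
    subst₂ (λ x y → edge G x y ≡ true) (sym (lookup-map i xEnd u)) (sym (lookup-map i yEnd u))
      (proj₂ (lookup u i))

  module _ {k : ℕ} {u v : Vec Edge k} where

    xEnds-≡⇒linked : xEnds u ≡ xEnds v → ∀ i → Linked (lookup u i) (lookup v i)
    xEnds-≡⇒linked eq i = lookup u i , inj₁ refl , inj₁ (map-≡-lookup xEnd eq i)

    yEnds-≡⇒linked : yEnds u ≡ yEnds v → ∀ i → Linked (lookup u i) (lookup v i)
    yEnds-≡⇒linked eq i = lookup u i , inj₂ refl , inj₂ (map-≡-lookup yEnd eq i)

    crossEdge⇒linked : E (Tensor k) (xEnds u) (yEnds v) →
                       ∀ i → Linked (lookup u i) (lookup v i)
    crossEdge⇒linked uv i =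
      ((xEnd (lookup u i) , yEnd (lookup v i)) ,
        subst₂ (λ x y → edge G x y ≡ true) (lookup-map i xEnd u) (lookup-map i yEnd v) (uv i))
      , inj₁ refl , inj₂ refl

  independent⇒inducedMatching :
    ∀ {k} {S : List (Vec Edge k)} → IsIndependent (Strong k) S →
    IsInducedMatching (Tensor k) (List.map endpoints S)
  independent⇒inducedMatching {k} {S} (unique , independent) =
    map⁺ endpoints-injective unique , isEdge , separated
    where
    isEdge : ∀ {m} → m ∈ List.map endpoints S → E (Tensor k) (proj₁ m) (proj₂ m)
    isEdge m∈ with ∈-map⁻ endpoints m∈
    ... | u , _ , refl = endpoints-edge u

    separated : ∀ {m m′} → m ∈ List.map endpoints S → m′ ∈ List.map endpoints S → m ≢ m′ →
                (proj₁ m ≢ proj₁ m′) × (proj₂ m ≢ proj₂ m′) × ¬ E (Tensor k) (proj₁ m) (proj₂ m′)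
    separated m∈ m′∈ m≢m′ with ∈-map⁻ endpoints m∈ | ∈-map⁻ endpoints m′∈
    ... | u , u∈S , refl | v , v∈S , refl =
      unlinked ∘ xEnds-≡⇒linked ,
      unlinked ∘ yEnds-≡⇒linked ,
      unlinked ∘ crossEdge⇒linked {u = u} {v}
      where
      unlinked : ¬ (∀ i → Linked (lookup u i) (lookup v i))
      unlinked = independent u∈S v∈S ∘ linked⇒adjacent {u = u} {v} (m≢m′ ∘ cong endpoints)

  independent⇒inducedMatchingOfSize :
    ∀ {k s} → HasIndependentOfSize (Strong k) s →
    HasInducedMatchingOfSize (Tensor k) s
  independent⇒inducedMatchingOfSize (S , independent , |S|≡s) =
    List.map endpoints S , independent⇒inducedMatching independent ,
    trans (length-map endpoints S) |S|≡s

lemma44 : (G : BipartiteGraph) → ThetaLineSquare≤mimsup G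
lemma44 G = ⇒-limsupRootLe (independent⇒inducedMatchingOfSize G)
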